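{- Let $G$ be a connected graph with $n$ vertices and $m$ edges. Then $tmc(G)=m+n-4$ if and only if $G\in\{K_n-P_4,\ K_n-2K_2,\ K_n-K_4,\ K_n-(K_4-K_2),\ K_n-(K_4-P_3),\ K_n-C_4,\ K_n-K_{1,3}\}$.
   Context: All graphs are simple, finite and undirected. A graph is total-colored if all its edges and all its vertices are assigned colors. A path in a total-colored graph is a total monochromatic path if all its edges and all its internal vertices have the same color. A total-coloring is a TMC-coloring if any two vertices are connected by a total monochromatic path. For a connected graph $G$, $tmc(G)$ is the maximum number of colors used in a TMC-coloring of $G$. For a graph $H$, $K_n-H$ denotes the graph obtained from $K_n$ (resp. $K_4$ for $K_4-H$) by deleting the edges of a copy of $H$. $P_k$ is the path on $k$ vertices, $C_4$ the $4$-cycle, $K_{1,3}$ the star with three edges, and $2K_2$ denotes two vertex-disjoint edges. -}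

module Defs where

open import Data.Nat using (ℕ; _+_; _<ᵇ_)
open import Data.Fin using (Fin; toℕ; zero; suc; _≟_)
open import Data.Bool using (Bool; true; false; T; _∧_; _∨_; if_then_else_)
open import Data.List using (List; []; _∷_; _++_; map; allFin)
open import Data.Nat.ListAction using (sum)
open import Data.Bool.ListAction using (any)
open import Data.List.Relation.Unary.All using (All)
open import Data.List.Relation.Unary.Linked using (Linked)
open import Data.List.Relation.Unary.Unique.Propositional using (Unique)
open import Data.Product using (Σ; ∃; _×_; _,_)
open import Data.Sum using (_⊎_)
open import Relation.Nullary using (¬_; Dec; yes; no)
open import Relation.Nullary.Decidable using (⌊_⌋)
open import Relation.Binary.PropositionalEquality using (_≡_; _≢_)
open import Function.Definitions using (Injective)

record Graph (n : ℕ) : Set where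
  field
    adj   : Fin n → Fin n → Bool
    sym   : ∀ i j → adj i j ≡ adj j i
    irrefl : ∀ i → adj i i ≡ false
open Graph public

edgeCount : ∀ {n} → Graph n → ℕ
edgeCount {n} G =
  sum (map (λ i → sum (map (λ j → if adj G i j ∧ (toℕ i <ᵇ toℕ j) then 1 else 0)
                          (allFin n)))
           (allFin n))

seqOf : ∀ {n} → Fin n → List (Fin n) → Fin n → List (Fin n)
seqOf u mid v = u ∷ (mid ++ v ∷ [])

IsPath : ∀ {n} → Graph n → Fin n → List (Fin n) → Fin n → Set
IsPath G u mid v =
  Unique (seqOf u mid v) × Linked (λ x y → T (adj G x y)) (seqOf u mid v)

Connected : ∀ {n} → Graph n → Set
Connected {n} G = ∀ (u v : Fin n) → u ≢ v → ∃ λ mid → IsPath G u mid v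

record TotalColoring {n} (G : Graph n) (k : ℕ) : Set where
  field
    vcol    : Fin n → Fin k
    ecol    : Fin n → Fin n → Fin k
    ecolSym : ∀ i j → T (adj G i j) → ecol i j ≡ ecol j i
open TotalColoring public

-- The coloring uses all k colors (so exactly k colors are used).
UsesAll : ∀ {n k} {G : Graph n} → TotalColoring G k → Set
UsesAll {n} {k} {G} c =
  ∀ (a : Fin k) → (∃ λ (v : Fin n) → vcol c v ≡ a)
                ⊎ (∃ λ (i : Fin n) → ∃ λ (j : Fin n) → T (adj G i j) × ecol c i j ≡ a)

IsTMPath : ∀ {n k} {G : Graph n} → TotalColoring G k → Fin k →
           Fin n → List (Fin n) → Fin n → Set
IsTMPath {G = G} c a u mid v =
  Unique (seqOf u mid v)
  × Linked (λ x y → T (adj G x y) × ecol c x y ≡ a) (seqOf u mid v)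
  × All (λ x → vcol c x ≡ a) mid

IsTMC : ∀ {n k} {G : Graph n} → TotalColoring G k → Set
IsTMC {n} {k} c =
  ∀ (u v : Fin n) → u ≢ v → ∃ λ (a : Fin k) → ∃ λ mid → IsTMPath c a u mid v

HasTMC : ∀ {n} → Graph n → ℕ → Set
HasTMC G k = Σ (TotalColoring G k) λ c → UsesAll c × IsTMC c

TmcIs : ∀ {n} → Graph n → ℕ → Set
TmcIs G k = HasTMC G k × (∀ k' → HasTMC G k' → k' Data.Nat.≤ k)

fromEdges : List (Fin 4 × Fin 4) → Fin 4 → Fin 4 → Bool
fromEdges es a b =
  any (λ { (x , y) → (⌊ x ≟ a ⌋ ∧ ⌊ y ≟ b ⌋) ∨ (⌊ x ≟ b ⌋ ∧ ⌊ y ≟ a ⌋) }) es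

v0 v1 v2 v3 : Fin 4
v0 = zero
v1 = suc zero
v2 = suc (suc zero)
v3 = suc (suc (suc zero))

P4 2K2 K4 K4-K2 K4-P3 C4 K13 : Fin 4 → Fin 4 → Bool
P4    = fromEdges ((v0 , v1) ∷ (v1 , v2) ∷ (v2 , v3) ∷ [])
2K2   = fromEdges ((v0 , v1) ∷ (v2 , v3) ∷ [])
K4    = fromEdges ((v0 , v1) ∷ (v0 , v2) ∷ (v0 , v3) ∷ (v1 , v2) ∷ (v1 , v3) ∷ (v2 , v3) ∷ [])
K4-K2 = fromEdges ((v0 , v2) ∷ (v0 , v3) ∷ (v1 , v2) ∷ (v1 , v3) ∷ (v2 , v3) ∷ [])
K4-P3 = fromEdges ((v0 , v2) ∷ (v0 , v3) ∷ (v1 , v3) ∷ (v2 , v3) ∷ [])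
C4    = fromEdges ((v0 , v1) ∷ (v1 , v2) ∷ (v2 , v3) ∷ (v3 , v0) ∷ [])
K13   = fromEdges ((v0 , v1) ∷ (v0 , v2) ∷ (v0 , v3) ∷ [])

-- G = K_n - H (up to isomorphism) for a graph H on 4 vertices: there is an
-- embedding f of V(H) into V(G) such that two distinct vertices of G are
-- non-adjacent exactly when they are the image of an edge of H.
IsKnMinus : ∀ {n} → Graph n → (Fin 4 → Fin 4 → Bool) → Set
IsKnMinus {n} G H =
  Σ (Fin 4 → Fin n) λ f → Injective _≡_ _≡_ f ×
    (∀ (i j : Fin n) → i ≢ j →
       (T (adj G i j) → ¬ (∃ λ a → ∃ λ b → f a ≡ i × f b ≡ j × T (H a b)))
     × (¬ (∃ λ a → ∃ λ b → f a ≡ i × f b ≡ j × T (H a b)) → T (adj G i j)))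

InFamily : ∀ {n} → Graph n → Set
InFamily G = IsKnMinus G P4 ⊎ IsKnMinus G 2K2 ⊎ IsKnMinus G K4 ⊎ IsKnMinus G K4-K2
           ⊎ IsKnMinus G K4-P3 ⊎ IsKnMinus G C4 ⊎ IsKnMinus G K13

-- Call a vertex non-dominating if it has a non-neighbour, and let U be the set of these vertices.
-- In a TMC-colouring, a monochromatic path from u ∈ U to a non-neighbour has an interior, so its
-- first edge has the colour of its second vertex; choosing one such redundant element per u, and
-- choosing them injectively, shows that at most n + m − |U| colours are used.  Conversely, giving a
-- class S of elements one colour and every other element its own colour is a TMC-colouring with
-- n + m − |S| + 1 colours whenever every non-adjacent pair is joined by a path inside S.  With a
-- dominating vertex w, the star of w gives tmc(G) = n + m − |U|, so tmc(G) = n + m − 4 iff |U| = 4, and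
-- the non-edges among four such vertices form one of the seven graphs on four vertices without
-- isolated vertices (an exhaustive check).  Without a dominating vertex the upper bound forces n = 4;
-- of the seven complements only those of P4 and 2K2 are connected, and a Hamiltonian path of each
-- serves as S.

module Submission where

open import Defs hiding (sym)
open import Data.Nat using (ℕ; zero; suc; _+_; _≤_; _<ᵇ_; s≤s; s≤s⁻¹)
import Data.Nat.Properties as ℕ
open import Data.Fin using (Fin; zero; suc; toℕ; _≟_; _<_)
open import Data.Fin.Patterns using (0F; 1F; 2F; 3F)
open import Data.Fin.Properties using (_<?_; <-asym; <-cmp; injective⇒≤; all?; any?)
open import Data.Bool using (Bool; true; false; T; T?; _∧_; _∨_; not; if_then_else_)
import Data.Bool.Properties as Bool
open import Data.Maybe using (Maybe; just; nothing)
import Data.Maybe.Properties as Maybe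
open import Data.List
  using (List; []; _∷_; _++_; map; filter; filterᵇ; allFin; length; lookup; cartesianProduct; concatMap)
open import Data.List.Properties using (length-++; length-map; length-tabulate; filter-++; filter-all; map-∘; map-++)
open import Data.Nat.ListAction using (sum)
open import Data.List.Membership.Propositional using (_∈_; _∉_)
open import Data.List.Membership.Propositional.Properties
  using ( ∈-lookup; ∈-allFin; ∈-map⁺; ∈-map⁻; ∈-++⁺ˡ; ∈-++⁺ʳ; ∈-++⁻; ∈-filter⁺; ∈-filter⁻
        ; ∈-cartesianProduct⁺)
open import Data.List.Relation.Binary.Subset.Propositional using (_⊆_)
open import Data.List.Relation.Unary.All as All using (All; []; _∷_)
open import Data.List.Relation.Unary.Any as Any using (here; there; index)
open import Data.List.Relation.Unary.Any.Properties using (lookup-index)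
open import Data.List.Relation.Unary.AllPairs using ([]; _∷_)
open import Data.List.Relation.Unary.Linked as Linked using (Linked; []; [-]; _∷_)
import Data.List.Relation.Unary.Linked.Properties as Linkedₚ
import Data.List.Relation.Unary.All.Properties as Allₚ
open import Data.List.Relation.Unary.Unique.Propositional using (Unique)
import Data.List.Relation.Unary.Unique.DecPropositional (_≟_ {4}) as UniqueFin
import Data.List.Relation.Unary.Unique.Propositional.Properties as Unique
open import Data.Product using (∃; _×_; _,_; proj₁; proj₂; swap)
open import Data.Product.Properties using (≡-dec; ,-injective)
open import Data.Sum using (_⊎_; inj₁; inj₂)
open import Function using (_∘_)
open import Function.Bundles using (Equivalence; _⇔_; mk⇔)
open import Relation.Nullary using (¬_; Dec; yes; no; does; contradiction; ¬?)
open import Relation.Nullary.Decidable using (map′; _×-dec_; _→-dec_; True; toWitness; ⌊_⌋)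
open import Relation.Unary using (Pred; Decidable)
open import Relation.Unary.Properties using (∁?)
open import Relation.Binary using (tri<; tri≈; tri>; DecidableEquality)
open import Relation.Binary.PropositionalEquality
  using (_≡_; _≢_; refl; sym; trans; cong; cong₂; subst; module ≡-Reasoning)

private variable
  A B : Set
  n k : ℕ

-- Lists

≤-+suc⁻¹ : ∀ {a} b {c} → suc a ≤ b + suc c → a ≤ b + c
≤-+suc⁻¹ {a} b {c} le = s≤s⁻¹ (subst (suc a ≤_) (ℕ.+-suc b c) le)

lookup-injective : {xs : List A} → Unique xs → ∀ i j → lookup xs i ≡ lookup xs j → i ≡ j
lookup-injective (_ ∷ _) zero zero _ = refl
lookup-injective (x∉ ∷ _) zero (suc j) eq = contradiction eq (All.lookup x∉ (∈-lookup j))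
lookup-injective (x∉ ∷ _) (suc i) zero eq = contradiction (sym eq) (All.lookup x∉ (∈-lookup i))
lookup-injective (_ ∷ xs!) (suc i) (suc j) eq = cong suc (lookup-injective xs! i j eq)

index-injective : {x y : A} {xs : List A} (p : x ∈ xs) (q : y ∈ xs) → index p ≡ index q → x ≡ y
index-injective {xs = xs} p q eq = trans (lookup-index p) (trans (cong (lookup xs) eq) (sym (lookup-index q)))

Unique⇒length≤ : {xs ys : List A} → Unique xs → xs ⊆ ys → length xs ≤ length ys
Unique⇒length≤ xs! xs⊆ys = injective⇒≤ {f = λ i → index (xs⊆ys (∈-lookup i))}
  λ {i} {j} eq → lookup-injective xs! i j (index-injective (xs⊆ys (∈-lookup i)) (xs⊆ys (∈-lookup j)) eq)

covering⇒≤length : (f : A → Fin k) {xs : List A} → (∀ c → ∃ λ x → x ∈ xs × f x ≡ c) → k ≤ length xs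
covering⇒≤length f cover = injective⇒≤ {f = λ c → index (proj₁ (proj₂ (cover c)))} λ {c} {c′} eq →
  let (x , x∈ , fx≡c) = cover c ; (x′ , x′∈ , fx′≡c′) = cover c′
  in trans (sym fx≡c) (trans (cong f (index-injective x∈ x′∈ eq)) fx′≡c′)

length-filter-∁ : ∀ {p} {P : Pred A p} (P? : Decidable P) (xs : List A) →
  length (filter P? xs) + length (filter (∁? P?) xs) ≡ length xs
length-filter-∁ P? [] = refl
length-filter-∁ P? (x ∷ xs) with does (P? x)
... | true = cong suc (length-filter-∁ P? xs)
... | false = trans (ℕ.+-suc _ _) (cong suc (length-filter-∁ P? xs))

length-filterᵇ : (p : A → Bool) (xs : List A) → length (filterᵇ p xs) ≡ sum (map (λ x → if p x then 1 else 0) xs)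
length-filterᵇ p [] = refl
length-filterᵇ p (x ∷ xs) with p x
... | true = cong suc (length-filterᵇ p xs)
... | false = length-filterᵇ p xs

length-filterᵇ-cartesianProduct : (p : A × B → Bool) (xs : List A) (ys : List B) →
  length (filterᵇ p (cartesianProduct xs ys))
    ≡ sum (map (λ x → sum (map (λ y → if p (x , y) then 1 else 0) ys)) xs)
length-filterᵇ-cartesianProduct p [] ys = refl
length-filterᵇ-cartesianProduct p (x ∷ xs) ys = begin
  length (filterᵇ p (map (x ,_) ys ++ cartesianProduct xs ys))
    ≡⟨ cong length (filter-++ (T? ∘ p) (map (x ,_) ys) _) ⟩
  length (filterᵇ p (map (x ,_) ys) ++ filterᵇ p (cartesianProduct xs ys))
    ≡⟨ length-++ (filterᵇ p (map (x ,_) ys)) ⟩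
  length (filterᵇ p (map (x ,_) ys)) + length (filterᵇ p (cartesianProduct xs ys))
    ≡⟨ cong₂ _+_ (trans (length-filterᵇ p (map (x ,_) ys)) (cong sum (sym (map-∘ ys))))
                 (length-filterᵇ-cartesianProduct p xs ys) ⟩
  sum (map (λ y → if p (x , y) then 1 else 0) ys)
    + sum (map (λ x → sum (map (λ y → if p (x , y) then 1 else 0) ys)) xs) ∎
  where open ≡-Reasoning

-- Elements of a graph

data Element (n : ℕ) : Set where
  vertex : Fin n → Element n
  edge   : Fin n × Fin n → Element n

vertex-injective : {u v : Fin n} → vertex u ≡ vertex v → u ≡ v
vertex-injective refl = refl

edge-injective : {e e′ : Fin n × Fin n} → edge e ≡ edge e′ → e ≡ e′
edge-injective refl = refl

_≟ᴱ_ : DecidableEquality (Element n)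
vertex u ≟ᴱ vertex v = map′ (cong vertex) vertex-injective (u ≟ v)
edge e   ≟ᴱ edge e′  = map′ (cong edge) edge-injective (≡-dec _≟_ _≟_ e e′)
vertex _ ≟ᴱ edge _   = no λ ()
edge _   ≟ᴱ vertex _ = no λ ()

_∈ᴱ?_ : (x : Element n) (xs : List (Element n)) → Dec (x ∈ xs)
x ∈ᴱ? xs = Any.any? (x ≟ᴱ_) xs

-- The element representing the edge {i, j}: the pair is ordered by the labels, as in edgeCount.
edgeBetween : Fin n → Fin n → Element n
edgeBetween i j with <-cmp i j
... | tri> _ _ _ = edge (j , i)
... | _ = edge (i , j)

edgeBetween-< : {i j : Fin n} → i < j → edgeBetween i j ≡ edge (i , j)
edgeBetween-< {i = i} {j} i<j with <-cmp i j
... | tri< _ _ _ = refl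
... | tri≈ _ _ _ = refl
... | tri> i≮j _ _ = contradiction i<j i≮j

edgeBetween-comm : {i j : Fin n} → i ≢ j → edgeBetween i j ≡ edgeBetween j i
edgeBetween-comm {i = i} {j} i≢j with <-cmp i j | <-cmp j i
... | tri≈ _ i≡j _ | _ = contradiction i≡j i≢j
... | _ | tri≈ _ j≡i _ = contradiction (sym j≡i) i≢j
... | tri< _ _ _ | tri> _ _ _ = refl
... | tri> _ _ _ | tri< _ _ _ = refl
... | tri< i<j _ _ | tri< j<i _ _ = contradiction j<i (<-asym i<j)
... | tri> _ _ j<i | tri> _ _ i<j = contradiction j<i (<-asym i<j)

edgeBetween-cases : (i j : Fin n) → edgeBetween i j ≡ edge (i , j) ⊎ edgeBetween i j ≡ edge (j , i)
edgeBetween-cases i j with <-cmp i j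
... | tri< _ _ _ = inj₁ refl
... | tri≈ _ _ _ = inj₁ refl
... | tri> _ _ _ = inj₂ refl

edgeBetween-injective : {i j x y : Fin n} → edgeBetween i j ≡ edgeBetween x y →
  (i ≡ x × j ≡ y) ⊎ (i ≡ y × j ≡ x)
edgeBetween-injective {i = i} {j} {x} {y} eq with edgeBetween-cases i j | edgeBetween-cases x y
... | inj₁ p | inj₁ q = inj₁ (,-injective (edge-injective (trans (sym p) (trans eq q))))
... | inj₁ p | inj₂ q = inj₂ (,-injective (edge-injective (trans (sym p) (trans eq q))))
... | inj₂ p | inj₁ q = inj₂ (swap (,-injective (edge-injective (trans (sym p) (trans eq q)))))
... | inj₂ p | inj₂ q = inj₁ (swap (,-injective (edge-injective (trans (sym p) (trans eq q)))))

edgeBetween≢vertex : (i j v : Fin n) → edgeBetween i j ≢ vertex v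
edgeBetween≢vertex i j v eq with edgeBetween-cases i j
... | inj₁ p with trans (sym p) eq
...   | ()
edgeBetween≢vertex i j v eq | inj₂ p with trans (sym p) eq
...   | ()

module _ (G : Graph n) where

  Adjacent : Fin n → Fin n → Set
  Adjacent i j = T (adj G i j)

  adjacent⇒≢ : {i j : Fin n} → Adjacent i j → i ≢ j
  adjacent⇒≢ {i} i~j refl = subst T (irrefl G i) i~j

  adjacent-sym : {i j : Fin n} → Adjacent i j → Adjacent j i
  adjacent-sym {i} {j} = subst T (Graph.sym G i j)

  adjacent-nonAdjacent⇒≢ : {a b c : Fin n} → Adjacent a b → adj G a c ≡ false → b ≢ c
  adjacent-nonAdjacent⇒≢ a~b a≁c refl = subst T a≁c a~b

  isEdge : Fin n × Fin n → Bool
  isEdge (i , j) = adj G i j ∧ (toℕ i <ᵇ toℕ j)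

  orderedEdges : List (Fin n × Fin n)
  orderedEdges = filterᵇ isEdge (cartesianProduct (allFin n) (allFin n))

  elements : List (Element n)
  elements = map vertex (allFin n) ++ map edge orderedEdges

  length-elements : length elements ≡ n + edgeCount G
  length-elements = begin
    length elements
      ≡⟨ length-++ (map vertex (allFin n)) ⟩
    length (map vertex (allFin n)) + length (map edge orderedEdges)
      ≡⟨ cong₂ _+_ (trans (length-map vertex (allFin n)) (length-tabulate (λ i → i)))
                   (trans (length-map edge orderedEdges) (length-filterᵇ-cartesianProduct isEdge (allFin n) (allFin n))) ⟩
    n + edgeCount G ∎
    where open ≡-Reasoning

  elements-unique : Unique elements
  elements-unique = Unique.++⁺
    (Unique.map⁺ vertex-injective (Unique.allFin⁺ n))
    (Unique.map⁺ edge-injective (Unique.filter⁺ (T? ∘ isEdge)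
      (Unique.cartesianProduct⁺ (Unique.allFin⁺ n) (Unique.allFin⁺ n))))
    λ (v∈ , e∈) → let (_ , _ , x≡v) = ∈-map⁻ vertex v∈ ; (_ , _ , x≡e) = ∈-map⁻ edge e∈
                  in contradiction (trans (sym x≡v) x≡e) λ ()

  vertex∈elements : (v : Fin n) → vertex v ∈ elements
  vertex∈elements v = ∈-++⁺ˡ (∈-map⁺ vertex (∈-allFin v))

  edge∈elements : {i j : Fin n} → Adjacent i j → i < j → edge (i , j) ∈ elements
  edge∈elements {i} {j} i~j i<j = ∈-++⁺ʳ (map vertex (allFin n)) (∈-map⁺ edge
    (∈-filter⁺ (T? ∘ isEdge) (∈-cartesianProduct⁺ (∈-allFin i) (∈-allFin j))
      (Equivalence.from Bool.T-∧ (i~j , ℕ.<⇒<ᵇ i<j))))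

  edgeBetween∈elements : {i j : Fin n} → Adjacent i j → edgeBetween i j ∈ elements
  edgeBetween∈elements {i} {j} i~j with <-cmp i j
  ... | tri< i<j _ _ = edge∈elements i~j i<j
  ... | tri≈ _ i≡j _ = contradiction i≡j (adjacent⇒≢ i~j)
  ... | tri> _ _ j<i = edge∈elements (adjacent-sym i~j) j<i

  ∈elements⇒edge : {i j : Fin n} → edge (i , j) ∈ elements → Adjacent i j × edgeBetween i j ≡ edge (i , j)
  ∈elements⇒edge {i} {j} e∈ with ∈-++⁻ (map vertex (allFin n)) e∈
  ... | inj₁ v∈ with ∈-map⁻ vertex v∈
  ...   | _ , _ , ()
  ∈elements⇒edge {i} {j} e∈ | inj₂ e∈′ with ∈-map⁻ edge e∈′
  ...   | _ , p∈ , refl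
    with Equivalence.to Bool.T-∧ (proj₂ (∈-filter⁻ (T? ∘ isEdge) {xs = cartesianProduct (allFin n) (allFin n)} p∈))
  ...     | i~j , i<ᵇj = i~j , edgeBetween-< (ℕ.<ᵇ⇒< (toℕ i) (toℕ j) i<ᵇj)

colourOf : {G : Graph n} → TotalColoring G k → Element n → Fin k
colourOf c (vertex v) = vcol c v
colourOf c (edge (i , j)) = ecol c i j

colourOf-edgeBetween : {G : Graph n} (c : TotalColoring G k) {i j : Fin n} → Adjacent G i j →
  colourOf c (edgeBetween i j) ≡ ecol c i j
colourOf-edgeBetween {G = G} c {i} {j} i~j with edgeBetween-cases i j
... | inj₁ eq rewrite eq = refl
... | inj₂ eq rewrite eq = ecolSym c j i (adjacent-sym G i~j)

-- Colourings with a monochromatic class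

module _ (G : Graph n) (S : List (Element n)) where

  outside : List (Element n)
  outside = filter (∁? (_∈ᴱ? S)) (elements G)

  outside-unique : Unique outside
  outside-unique = Unique.filter⁺ (∁? (_∈ᴱ? S)) (elements-unique G)

  private
    inside : List (Element n)
    inside = filter (_∈ᴱ? S) (elements G)

    length-inside+outside : length inside + length outside ≡ n + edgeCount G
    length-inside+outside = trans (length-filter-∁ (_∈ᴱ? S) (elements G)) (length-elements G)

  n+m≤outside+S : n + edgeCount G ≤ length outside + length S
  n+m≤outside+S = begin
    n + edgeCount G               ≡⟨ sym length-inside+outside ⟩
    length inside + length outside ≤⟨ ℕ.+-monoˡ-≤ (length outside) inside≤S ⟩
    length S + length outside      ≡⟨ ℕ.+-comm (length S) (length outside) ⟩
    length outside + length S      ∎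
    where
    open ℕ.≤-Reasoning
    inside≤S : length inside ≤ length S
    inside≤S = Unique⇒length≤ (Unique.filter⁺ (_∈ᴱ? S) (elements-unique G))
      (proj₂ ∘ ∈-filter⁻ (_∈ᴱ? S) {xs = elements G})

  outside+S≤n+m : Unique S → S ⊆ elements G → length outside + length S ≤ n + edgeCount G
  outside+S≤n+m S! S⊆ = begin
    length outside + length S      ≤⟨ ℕ.+-monoʳ-≤ (length outside) S≤inside ⟩
    length outside + length inside ≡⟨ ℕ.+-comm (length outside) (length inside) ⟩
    length inside + length outside ≡⟨ length-inside+outside ⟩
    n + edgeCount G                ∎
    where
    open ℕ.≤-Reasoning
    S≤inside : length S ≤ length inside
    S≤inside = Unique⇒length≤ S! λ e∈S → ∈-filter⁺ (_∈ᴱ? S) (S⊆ e∈S) e∈S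

PathIn : Graph n → List (Element n) → Fin n → List (Fin n) → Fin n → Set
PathIn G S u mid v =
  Unique (seqOf u mid v)
  × Linked (λ x y → Adjacent G x y × edgeBetween x y ∈ S) (seqOf u mid v)
  × All (λ x → vertex x ∈ S) mid

module ClassColouring (G : Graph n) (S : List (Element n)) {w : Fin n} (w∈S : vertex w ∈ S)
  (joined : ∀ u v → u ≢ v → adj G u v ≡ false → ∃ λ mid → PathIn G S u mid v) where

  colour : Element n → Fin (suc (length (outside G S)))
  colour e with e ∈ᴱ? S | e ∈ᴱ? outside G S
  ... | yes _ | _ = zero
  ... | no _ | yes e∈ = suc (index e∈)
  ... | no _ | no _ = zero   -- reached only by non-elements such as edge (j , i) with i < j

  colour-∈ : {e : Element n} → e ∈ S → colour e ≡ zero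
  colour-∈ {e} e∈S with e ∈ᴱ? S
  ... | yes _ = refl
  ... | no e∉S = contradiction e∈S e∉S

  colour-outside : ∀ a → colour (lookup (outside G S) a) ≡ suc a
  colour-outside a with lookup (outside G S) a ∈ᴱ? S | lookup (outside G S) a ∈ᴱ? outside G S
  ... | yes e∈S | _ = contradiction e∈S (proj₂ (∈-filter⁻ (∁? (_∈ᴱ? S)) {xs = elements G} (∈-lookup a)))
  ... | no _ | yes e∈ = cong suc (lookup-injective (outside-unique G S) (index e∈) a (sym (lookup-index e∈)))
  ... | no _ | no e∉ = contradiction (∈-lookup a) e∉

  colouring : TotalColoring G (suc (length (outside G S)))
  colouring = record
    { vcol = colour ∘ vertex
    ; ecol = λ i j → colour (edgeBetween i j)
    ; ecolSym = λ i j i~j → cong colour (edgeBetween-comm (adjacent⇒≢ G i~j))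
    }

  usesAll : UsesAll colouring
  usesAll zero = inj₁ (w , colour-∈ w∈S)
  usesAll (suc a)
    with lookup (outside G S) a | colour-outside a | proj₁ (∈-filter⁻ (∁? (_∈ᴱ? S)) {xs = elements G} (∈-lookup a))
  ... | vertex v | coloured | _ = inj₁ (v , coloured)
  ... | edge (i , j) | coloured | e∈ =
    let (i~j , ordered) = ∈elements⇒edge G e∈ in inj₂ (i , j , i~j , trans (cong colour ordered) coloured)

  isTMC : IsTMC colouring
  isTMC u v u≢v with adj G u v in u~v
  ... | true = colour (edgeBetween u v) , [] , (u≢v ∷ []) ∷ [] ∷ [] , (subst T (sym u~v) _ , refl) ∷ [-] , []
  ... | false with joined u v u≢v u~v
  ...   | mid , mid! , links , inner =
    zero , mid , mid! , Linked.map (λ (x~y , e∈) → x~y , colour-∈ e∈) links , All.map colour-∈ inner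

class-colouring : (G : Graph n) (S : List (Element n)) {w : Fin n} → vertex w ∈ S →
  (∀ u v → u ≢ v → adj G u v ≡ false → ∃ λ mid → PathIn G S u mid v) →
  ∃ λ K → HasTMC G K × suc (n + edgeCount G) ≤ K + length S
class-colouring G S w∈S joined =
  suc (length (outside G S)) , (colouring , usesAll , isTMC) , s≤s (n+m≤outside+S G S)
  where open ClassColouring G S w∈S joined

-- Dominating vertices

Dominating : Graph n → Fin n → Set
Dominating G w = ∀ v → w ≢ v → Adjacent G w v

dominating? : (G : Graph n) → Decidable (Dominating G)
dominating? G w = all? λ v → ¬? (w ≟ v) →-dec T? (adj G w v)

nonDominating : Graph n → List (Fin n)
nonDominating {n} G = filter (∁? (dominating? G)) (allFin n)

module _ (G : Graph n) where

  nonDominating-unique : Unique (nonDominating G)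
  nonDominating-unique = Unique.filter⁺ (∁? (dominating? G)) (Unique.allFin⁺ n)

  nonAdjacent⇒nonDominating : {u v : Fin n} → u ≢ v → adj G u v ≡ false → u ∈ nonDominating G
  nonAdjacent⇒nonDominating {u} {v} u≢v u≁v =
    ∈-filter⁺ (∁? (dominating? G)) (∈-allFin u) λ dom → subst T u≁v (dom v u≢v)

  noDominating⇒all : ¬ ∃ (Dominating G) → ∀ v → v ∈ nonDominating G
  noDominating⇒all none v = ∈-filter⁺ (∁? (dominating? G)) (∈-allFin v) λ v-dom → none (v , v-dom)

  noDominating⇒length : ¬ ∃ (Dominating G) → length (nonDominating G) ≡ n
  noDominating⇒length none = trans
    (cong length (filter-all (∁? (dominating? G)) (All.tabulate {xs = allFin n} λ {v} _ v-dom → none (v , v-dom))))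
    (length-tabulate (λ i → i))

  nonDominating⇒nonNeighbour : {u : Fin n} → u ∈ nonDominating G → ∃ λ v → u ≢ v × adj G u v ≡ false
  nonDominating⇒nonNeighbour {u} u∈ with any? (λ v → ¬? (u ≟ v) ×-dec (adj G u v Bool.≟ false))
  ... | yes found = found
  ... | no none = contradiction dominating (proj₂ (∈-filter⁻ (∁? (dominating? G)) {xs = allFin n} u∈))
    where
    dominating : Dominating G u
    dominating v u≢v with adj G u v in u~v
    ... | true = _
    ... | false = contradiction (v , u≢v , u~v) none

-- The upper bound

-- Each non-dominating u has a neighbour x with ecol u x ≡ vcol x (its partner), which makes one element
-- redundant: the edge ux or, when x < u has u as its own partner, the vertex u (then u, x and ux share
-- a colour).  These elements are distinct, and every colour survives on the remaining ones.
module UpperBound {G : Graph n} (c : TotalColoring G k) (c-uses : UsesAll c) (c-tmc : IsTMC c) where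

  Repeats : Fin n → Fin n → Set
  Repeats u x = Adjacent G u x × ecol c u x ≡ vcol c x

  repeats? : ∀ u → Dec (∃ (Repeats u))
  repeats? u = any? λ x → T? (adj G u x) ×-dec (ecol c u x ≟ vcol c x)

  nonDominating⇒repeats : {u : Fin n} → u ∈ nonDominating G → ∃ (Repeats u)
  nonDominating⇒repeats u∈ with nonDominating⇒nonNeighbour G u∈
  ... | v , u≢v , u≁v with c-tmc _ v u≢v
  ...   | _ , [] , _ , (u~v , _) ∷ _ , _ = contradiction (subst T u≁v u~v) λ ()
  ...   | _ , x ∷ _ , _ , (u~x , ux≡a) ∷ _ , x≡a ∷ _ = x , u~x , trans ux≡a (sym x≡a)

  partner : Fin n → Maybe (Fin n)
  partner u with repeats? u
  ... | yes (x , _) = just x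
  ... | no _ = nothing

  partner-repeats : {u x : Fin n} → partner u ≡ just x → Repeats u x
  partner-repeats {u} eq with repeats? u | eq
  ... | yes (_ , r) | refl = r

  nonDominating⇒partner : {u : Fin n} → u ∈ nonDominating G → ∃ λ x → partner u ≡ just x
  nonDominating⇒partner {u} u∈ with repeats? u
  ... | yes (x , _) = x , refl
  ... | no ¬r = contradiction (nonDominating⇒repeats u∈) ¬r

  Absorbed : Fin n → Fin n → Set
  Absorbed u x = x < u × partner x ≡ just u

  absorbed? : ∀ u x → Dec (Absorbed u x)
  absorbed? u x = x <? u ×-dec Maybe.≡-dec _≟_ (partner x) (just u)

  redundant : Fin n → Element n
  redundant u with partner u
  ... | nothing = vertex u
  ... | just x with absorbed? u x
  ...   | yes _ = vertex u
  ...   | no _ = edgeBetween u x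

  data RedundantView (u : Fin n) (e : Element n) : Set where
    unpaired : partner u ≡ nothing → e ≡ vertex u → RedundantView u e
    absorbed : ∀ {x} → partner u ≡ just x → Absorbed u x → e ≡ vertex u → RedundantView u e
    paired   : ∀ {x} → partner u ≡ just x → ¬ Absorbed u x → e ≡ edgeBetween u x → RedundantView u e

  redundant-view : ∀ u → RedundantView u (redundant u)
  redundant-view u with partner u in pu
  ... | nothing = unpaired pu refl
  ... | just x with absorbed? u x
  ...   | yes ab = absorbed pu ab refl
  ...   | no ¬ab = paired pu ¬ab refl

  view-vertex-or-edge : ∀ {u e} → RedundantView u e →
    e ≡ vertex u ⊎ ∃ λ x → partner u ≡ just x × ¬ Absorbed u x × e ≡ edgeBetween u x
  view-vertex-or-edge (unpaired _ e≡) = inj₁ e≡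
  view-vertex-or-edge (absorbed _ _ e≡) = inj₁ e≡
  view-vertex-or-edge (paired pu ¬ab e≡) = inj₂ (_ , pu , ¬ab , e≡)

  mutual-partners : {u u′ : Fin n} → partner u ≡ just u′ → partner u′ ≡ just u →
    ¬ Absorbed u u′ → ¬ Absorbed u′ u → u ≡ u′
  mutual-partners {u} {u′} pu pu′ ¬ab ¬ab′ with <-cmp u u′
  ... | tri< u<u′ _ _ = contradiction (u<u′ , pu) ¬ab′
  ... | tri≈ _ u≡u′ _ = u≡u′
  ... | tri> _ _ u′<u = contradiction (u′<u , pu′) ¬ab

  view-injective : ∀ {u u′ e} → RedundantView u e → RedundantView u′ e → u ≡ u′
  view-injective {u} {u′} v v′ with view-vertex-or-edge v | view-vertex-or-edge v′
  ... | inj₁ e≡ | inj₁ e≡′ = vertex-injective (trans (sym e≡) e≡′)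
  ... | inj₁ e≡ | inj₂ (x′ , _ , _ , e≡′) = contradiction (trans (sym e≡′) e≡) (edgeBetween≢vertex u′ x′ u)
  ... | inj₂ (x , _ , _ , e≡) | inj₁ e≡′ = contradiction (trans (sym e≡) e≡′) (edgeBetween≢vertex u x u′)
  ... | inj₂ (x , pu , ¬ab , e≡) | inj₂ (x′ , pu′ , ¬ab′ , e≡′) with edgeBetween-injective (trans (sym e≡) e≡′)
  ...   | inj₁ (u≡u′ , _) = u≡u′
  ...   | inj₂ (refl , refl) = mutual-partners pu pu′ ¬ab ¬ab′

  redundant-injective : {u u′ : Fin n} → redundant u ≡ redundant u′ → u ≡ u′
  redundant-injective {u} {u′} eq = view-injective (redundant-view u) (subst (RedundantView u′) (sym eq) (redundant-view u′))

  redundants : List (Element n)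
  redundants = map redundant (nonDominating G)

  redundants-unique : Unique redundants
  redundants-unique = Unique.map⁺ redundant-injective (nonDominating-unique G)

  redundant∈elements : ∀ u → redundant u ∈ elements G
  redundant∈elements u with redundant u | redundant-view u
  ... | _ | unpaired _ refl = vertex∈elements G u
  ... | _ | absorbed _ _ refl = vertex∈elements G u
  ... | _ | paired pu _ refl = edgeBetween∈elements G (proj₁ (partner-repeats pu))

  redundants⊆elements : redundants ⊆ elements G
  redundants⊆elements e∈ with ∈-map⁻ redundant e∈
  ... | u , _ , refl = redundant∈elements u

  vertex∈redundants⇒absorbed : {w : Fin n} → vertex w ∈ redundants → ∃ λ x → partner w ≡ just x × Absorbed w x
  vertex∈redundants⇒absorbed w∈ with ∈-map⁻ redundant w∈
  ... | u , u∈ , eq with subst (RedundantView u) (sym eq) (redundant-view u)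
  ...   | unpaired pu w≡u with vertex-injective w≡u | nonDominating⇒partner u∈
  ...     | refl | _ , pu′ = contradiction (trans (sym pu) pu′) λ ()
  vertex∈redundants⇒absorbed w∈ | u , u∈ , eq | absorbed pu ab w≡u with vertex-injective w≡u
  ...     | refl = _ , pu , ab
  vertex∈redundants⇒absorbed w∈ | u , u∈ , eq | paired {x} _ _ w≡ =
    contradiction (sym w≡) (edgeBetween≢vertex u x _)

  kept : List (Element n)
  kept = outside G redundants

  vertex-kept : ∀ w → ∃ λ e → e ∈ kept × colourOf c e ≡ vcol c w
  vertex-kept w with vertex w ∈ᴱ? redundants
  ... | no w∉ = vertex w , ∈-filter⁺ (∁? (_∈ᴱ? redundants)) (vertex∈elements G w) w∉ , refl
  ... | yes w∈ with vertex∈redundants⇒absorbed w∈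
  ...   | x , pw , x<w , px = vertex x , ∈-filter⁺ (∁? (_∈ᴱ? redundants)) (vertex∈elements G x) x∉ , same
    where
    x∉ : vertex x ∉ redundants
    x∉ x∈ with vertex∈redundants⇒absorbed x∈
    ... | z , px′ , z<x , _ with trans (sym px) px′
    ...   | refl = <-asym x<w z<x
    same : vcol c x ≡ vcol c w
    same = begin
      vcol c x   ≡⟨ sym (proj₂ (partner-repeats pw)) ⟩
      ecol c w x ≡⟨ ecolSym c w x (proj₁ (partner-repeats pw)) ⟩
      ecol c x w ≡⟨ proj₂ (partner-repeats px) ⟩
      vcol c w   ∎
      where open ≡-Reasoning

  element-kept : {e : Element n} → e ∈ elements G → ∃ λ e′ → e′ ∈ kept × colourOf c e′ ≡ colourOf c e
  element-kept {vertex w} _ = vertex-kept w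
  element-kept {edge (i , j)} e∈ with edge (i , j) ∈ᴱ? redundants
  ... | no e∉ = edge (i , j) , ∈-filter⁺ (∁? (_∈ᴱ? redundants)) e∈ e∉ , refl
  ... | yes e∈R with ∈-map⁻ redundant e∈R
  ...   | u , _ , eq with subst (RedundantView u) (sym eq) (redundant-view u)
  ...     | unpaired _ () 
  ...     | absorbed _ _ ()
  ...     | paired {x} pu _ e≡ =
    let (e′ , e′∈ , e′≡x) = vertex-kept x ; (u~x , ux≡x) = partner-repeats pu
    in e′ , e′∈ , trans e′≡x (sym (trans (cong (colourOf c) e≡) (trans (colourOf-edgeBetween c u~x) ux≡x)))

  covering : ∀ a → ∃ λ e → e ∈ kept × colourOf c e ≡ a
  covering a with c-uses a
  ... | inj₁ (v , v≡a) = let (e , e∈ , e≡v) = vertex-kept v in e , e∈ , trans e≡v v≡a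
  ... | inj₂ (i , j , i~j , ij≡a) =
    let (e , e∈ , e≡ij) = element-kept (edgeBetween∈elements G i~j)
    in e , e∈ , trans e≡ij (trans (colourOf-edgeBetween c i~j) ij≡a)

  bound : k + length (nonDominating G) ≤ n + edgeCount G
  bound = begin
    k + length (nonDominating G)  ≡⟨ cong (k +_) (sym (length-map redundant (nonDominating G))) ⟩
    k + length redundants         ≤⟨ ℕ.+-monoˡ-≤ (length redundants) (covering⇒≤length (colourOf c) covering) ⟩
    length kept + length redundants ≤⟨ outside+S≤n+m G redundants redundants-unique redundants⊆elements ⟩
    n + edgeCount G               ∎
    where open ℕ.≤-Reasoning

tmc+nonDominating≤ : (G : Graph n) → HasTMC G k → k + length (nonDominating G) ≤ n + edgeCount G
tmc+nonDominating≤ G (c , c-uses , c-tmc) = UpperBound.bound c c-uses c-tmc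

tmc-from-colouring : (G : Graph n) → HasTMC G k → n + edgeCount G ≤ k + length (nonDominating G) →
  TmcIs G k × k + length (nonDominating G) ≡ n + edgeCount G
tmc-from-colouring {k = k} G h lower =
  (h , λ k′ h′ → ℕ.+-cancelʳ-≤ (length (nonDominating G)) k′ k (ℕ.≤-trans (tmc+nonDominating≤ G h′) lower)) ,
  ℕ.≤-antisym (tmc+nonDominating≤ G h) lower

-- Graphs with a dominating vertex

module _ (G : Graph n) {w : Fin n} (w-dom : Dominating G w) where

  dominating∉nonDominating : w ∉ nonDominating G
  dominating∉nonDominating w∈ = proj₂ (∈-filter⁻ (∁? (dominating? G)) {xs = allFin n} w∈) w-dom

  star : List (Element n)
  star = vertex w ∷ map (edgeBetween w) (nonDominating G)

  joined-through-star : ∀ u v → u ≢ v → adj G u v ≡ false → ∃ λ mid → PathIn G star u mid v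
  joined-through-star u v u≢v u≁v =
    w ∷ [] , (u≢w ∷ u≢v ∷ []) ∷ (w≢v ∷ []) ∷ [] ∷ [] ,
    (adjacent-sym G (w-dom u (u≢w ∘ sym)) , subst (_∈ star) (edgeBetween-comm (w≢u)) (spoke u∈)) ∷
    (w-dom v w≢v , spoke v∈) ∷ [-] ,
    here refl ∷ []
    where
    u∈ : u ∈ nonDominating G
    u∈ = nonAdjacent⇒nonDominating G u≢v u≁v
    v∈ : v ∈ nonDominating G
    v∈ = nonAdjacent⇒nonDominating G (u≢v ∘ sym) (trans (Graph.sym G v u) u≁v)
    spoke : ∀ {x} → x ∈ nonDominating G → edgeBetween w x ∈ star
    spoke x∈ = there (∈-map⁺ (edgeBetween w) x∈)
    u≢w : u ≢ w
    u≢w refl = dominating∉nonDominating u∈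
    w≢u : w ≢ u
    w≢u = u≢w ∘ sym
    w≢v : w ≢ v
    w≢v refl = dominating∉nonDominating v∈

  dominating-colouring : ∃ λ K → HasTMC G K × n + edgeCount G ≤ K + length (nonDominating G)
  dominating-colouring =
    let (K , h , lower) = class-colouring G star (here refl) joined-through-star
    in K , h , ≤-+suc⁻¹ K (subst (λ l → suc (n + edgeCount G) ≤ K + suc l)
                                 (length-map (edgeBetween w) (nonDominating G)) lower)

  tmc-dominating : TmcIs G k → k + length (nonDominating G) ≡ n + edgeCount G
  tmc-dominating {k} (h , maximal) =
    let (K , hK , lower) = dominating-colouring in ℕ.≤-antisym (tmc+nonDominating≤ G h)
    (ℕ.≤-trans lower (ℕ.+-monoˡ-≤ (length (nonDominating G)) (maximal K hK)))

-- Graphs on four vertices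

data Shape : Set where
  P4ˢ 2K2ˢ K4ˢ K4-K2ˢ K4-P3ˢ C4ˢ K13ˢ : Shape

shapes : List Shape
shapes = P4ˢ ∷ 2K2ˢ ∷ K4ˢ ∷ K4-K2ˢ ∷ K4-P3ˢ ∷ C4ˢ ∷ K13ˢ ∷ []

graphOf : Shape → Fin 4 → Fin 4 → Bool
graphOf P4ˢ    = P4
graphOf 2K2ˢ   = 2K2
graphOf K4ˢ    = K4
graphOf K4-K2ˢ = K4-K2
graphOf K4-P3ˢ = K4-P3
graphOf C4ˢ    = C4
graphOf K13ˢ   = K13

inFamily : {G : Graph n} (s : Shape) → IsKnMinus G (graphOf s) → InFamily G
inFamily P4ˢ    = inj₁
inFamily 2K2ˢ   = inj₂ ∘ inj₁
inFamily K4ˢ    = inj₂ ∘ inj₂ ∘ inj₁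
inFamily K4-K2ˢ = inj₂ ∘ inj₂ ∘ inj₂ ∘ inj₁
inFamily K4-P3ˢ = inj₂ ∘ inj₂ ∘ inj₂ ∘ inj₂ ∘ inj₁
inFamily C4ˢ    = inj₂ ∘ inj₂ ∘ inj₂ ∘ inj₂ ∘ inj₂ ∘ inj₁
inFamily K13ˢ   = inj₂ ∘ inj₂ ∘ inj₂ ∘ inj₂ ∘ inj₂ ∘ inj₂

shapeOf : {G : Graph n} → InFamily G → ∃ λ s → IsKnMinus G (graphOf s)
shapeOf (inj₁ h) = P4ˢ , h
shapeOf (inj₂ (inj₁ h)) = 2K2ˢ , h
shapeOf (inj₂ (inj₂ (inj₁ h))) = K4ˢ , h
shapeOf (inj₂ (inj₂ (inj₂ (inj₁ h)))) = K4-K2ˢ , h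
shapeOf (inj₂ (inj₂ (inj₂ (inj₂ (inj₁ h))))) = K4-P3ˢ , h
shapeOf (inj₂ (inj₂ (inj₂ (inj₂ (inj₂ (inj₁ h)))))) = C4ˢ , h
shapeOf (inj₂ (inj₂ (inj₂ (inj₂ (inj₂ (inj₂ h)))))) = K13ˢ , h

NoIsolated : (Fin 4 → Fin 4 → Bool) → Set
NoIsolated H = ∀ a → ∃ λ b → a ≢ b × T (H a b)

noIsolated? : ∀ H → Dec (NoIsolated H)
noIsolated? H = all? λ a → any? λ b → ¬? (a ≟ b) ×-dec T? (H a b)

shape-noIsolated : ∀ s → NoIsolated (graphOf s)
shape-noIsolated s = toWitness {a? = noIsolated? (graphOf s)} (checked s)
  where
  checked : ∀ s → True (noIsolated? (graphOf s))
  checked P4ˢ = _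
  checked 2K2ˢ = _
  checked K4ˢ = _
  checked K4-K2ˢ = _
  checked K4-P3ˢ = _
  checked C4ˢ = _
  checked K13ˢ = _

Edges₄ : Set
Edges₄ = Bool × Bool × Bool × Bool × Bool × Bool

graph₄ : Edges₄ → Fin 4 → Fin 4 → Bool
graph₄ (e , _ , _ , _ , _ , _) 0F 1F = e
graph₄ (_ , e , _ , _ , _ , _) 0F 2F = e
graph₄ (_ , _ , e , _ , _ , _) 0F 3F = e
graph₄ (_ , _ , _ , e , _ , _) 1F 2F = e
graph₄ (_ , _ , _ , _ , e , _) 1F 3F = e
graph₄ (_ , _ , _ , _ , _ , e) 2F 3F = e
graph₄ (e , _ , _ , _ , _ , _) 1F 0F = e
graph₄ (_ , e , _ , _ , _ , _) 2F 0F = e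
graph₄ (_ , _ , e , _ , _ , _) 3F 0F = e
graph₄ (_ , _ , _ , e , _ , _) 2F 1F = e
graph₄ (_ , _ , _ , _ , e , _) 3F 1F = e
graph₄ (_ , _ , _ , _ , _ , e) 3F 2F = e
graph₄ _ _ _ = false

edges₄ : (Fin 4 → Fin 4 → Bool) → Edges₄
edges₄ H = H 0F 1F , H 0F 2F , H 0F 3F , H 1F 2F , H 1F 3F , H 2F 3F

graph₄-edges₄ : (H : Fin 4 → Fin 4 → Bool) → (∀ a b → H a b ≡ H b a) →
  ∀ a b → a ≢ b → graph₄ (edges₄ H) a b ≡ H a b
graph₄-edges₄ H H-sym 0F 1F _ = refl
graph₄-edges₄ H H-sym 0F 2F _ = refl
graph₄-edges₄ H H-sym 0F 3F _ = refl
graph₄-edges₄ H H-sym 1F 2F _ = refl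
graph₄-edges₄ H H-sym 1F 3F _ = refl
graph₄-edges₄ H H-sym 2F 3F _ = refl
graph₄-edges₄ H H-sym 1F 0F _ = H-sym 0F 1F
graph₄-edges₄ H H-sym 2F 0F _ = H-sym 0F 2F
graph₄-edges₄ H H-sym 3F 0F _ = H-sym 0F 3F
graph₄-edges₄ H H-sym 2F 1F _ = H-sym 1F 2F
graph₄-edges₄ H H-sym 3F 1F _ = H-sym 1F 3F
graph₄-edges₄ H H-sym 3F 2F _ = H-sym 2F 3F
graph₄-edges₄ H H-sym 0F 0F a≢a = contradiction refl a≢a
graph₄-edges₄ H H-sym 1F 1F a≢a = contradiction refl a≢a
graph₄-edges₄ H H-sym 2F 2F a≢a = contradiction refl a≢a
graph₄-edges₄ H H-sym 3F 3F a≢a = contradiction refl a≢a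

_≅_via_ : (H H′ : Fin 4 → Fin 4 → Bool) → (Fin 4 → Fin 4) → Set
H ≅ H′ via g =
  (∀ a b → H a b ≡ H′ (g a) (g b)) × (∀ a b → g a ≡ g b → a ≡ b) × (∀ c → ∃ λ a → g a ≡ c)

_≅?_via_ : ∀ H H′ g → Dec (H ≅ H′ via g)
H ≅? H′ via g = (all? λ a → all? λ b → H a b Bool.≟ H′ (g a) (g b))
  ×-dec (all? λ a → all? λ b → g a ≟ g b →-dec a ≟ b)
  ×-dec (all? λ c → any? λ a → g a ≟ c)

private
  tuple : Fin 4 → Fin 4 → Fin 4 → Fin 4 → Fin 4 → Fin 4
  tuple a _ _ _ 0F = a
  tuple _ b _ _ 1F = b
  tuple _ _ c _ 2F = c
  tuple _ _ _ d 3F = d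

  maps₄ : List (Fin 4 → Fin 4)
  maps₄ = concatMap (λ a → concatMap (λ b → concatMap (λ c → map (tuple a b c)
            (allFin 4)) (allFin 4)) (allFin 4)) (allFin 4)

  forallBool? : {P : Bool → Set} → (∀ b → Dec (P b)) → Dec (∀ b → P b)
  forallBool? P? = map′ (λ { (t , f) true → t ; (t , f) false → f }) (λ h → h true , h false) (P? true ×-dec P? false)

  forallEdges₄? : {P : Edges₄ → Set} → Decidable P → Dec (∀ es → P es)
  forallEdges₄? P? = map′ (λ h (a , b , c , d , e , f) → h a b c d e f) (λ h a b c d e f → h (a , b , c , d , e , f))
    (forallBool? λ a → forallBool? λ b → forallBool? λ c → forallBool? λ d → forallBool? λ e → forallBool? λ f →
      P? (a , b , c , d , e , f))

  Classified : Edges₄ → Set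
  Classified es = Any.Any (λ s → Any.Any (λ g → graphOf s ≅ graph₄ es via g) maps₄) shapes

  classified? : ∀ es → Dec (Classified es)
  classified? es = Any.any? (λ s → Any.any? (λ g → graphOf s ≅? graph₄ es via g) maps₄) shapes

-- Checked by evaluation over all 64 graphs on Fin 4 and all maps Fin 4 → Fin 4.
opaque
  classification₄ : ∀ es → NoIsolated (graph₄ es) → ∃ λ s → ∃ λ g → graphOf s ≅ graph₄ es via g
  classification₄ es no-isolated =
    let (s , found) = Any.satisfied (classify es no-isolated) in s , Any.satisfied found
    where
    classify : ∀ es → NoIsolated (graph₄ es) → Classified es
    classify = toWitness {a? = forallEdges₄? λ es → noIsolated? (graph₄ es) →-dec classified? es} _

module KnMinus (G : Graph n) {H : Fin 4 → Fin 4 → Bool} (km : IsKnMinus G H) where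

  f : Fin 4 → Fin n
  f = proj₁ km

  f-injective : {a b : Fin 4} → f a ≡ f b → a ≡ b
  f-injective = proj₁ (proj₂ km)

  f-≢ : {a b : Fin 4} → a ≢ b → f a ≢ f b
  f-≢ a≢b = a≢b ∘ f-injective

  adjacent-image : {a b : Fin 4} → a ≢ b → H a b ≡ false → Adjacent G (f a) (f b)
  adjacent-image {a} {b} a≢b Hab = proj₂ (proj₂ (proj₂ km) (f a) (f b) (f-≢ a≢b))
    λ (a′ , b′ , fa′≡ , fb′≡ , Ha′b′) → subst T (trans (cong₂ H (f-injective fa′≡) (f-injective fb′≡)) Hab) Ha′b′

  nonAdjacent-image : {a b : Fin 4} → a ≢ b → T (H a b) → adj G (f a) (f b) ≡ false
  nonAdjacent-image {a} {b} a≢b Hab with adj G (f a) (f b) in fa~fb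
  ... | true = contradiction (a , b , refl , refl , Hab)
                 (proj₁ (proj₂ (proj₂ km) (f a) (f b) (f-≢ a≢b)) (subst T (sym fa~fb) _))
  ... | false = refl

  nonDominating⇒image : {v : Fin n} → v ∈ nonDominating G → ∃ λ a → f a ≡ v
  nonDominating⇒image {v} v∈ with any? (λ a → f a ≟ v) | nonDominating⇒nonNeighbour G v∈
  ... | yes found | _ = found
  ... | no none | u , v≢u , v≁u = contradiction
    (proj₂ (proj₂ (proj₂ km) v u v≢u) λ (a , _ , fa≡v , _) → none (a , fa≡v)) (subst (¬_ ∘ T) (sym v≁u) λ ())

  image-nonDominating : NoIsolated H → ∀ a → f a ∈ nonDominating G
  image-nonDominating no-isolated a =
    let (b , a≢b , Hab) = no-isolated a in nonAdjacent⇒nonDominating G (f-≢ a≢b) (nonAdjacent-image a≢b Hab)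

  length-nonDominating : NoIsolated H → length (nonDominating G) ≡ 4
  length-nonDominating no-isolated = ℕ.≤-antisym
    (Unique⇒length≤ (nonDominating-unique G) λ v∈ →
      let (a , fa≡v) = nonDominating⇒image v∈ in subst (_∈ map f (allFin 4)) fa≡v (∈-map⁺ f (∈-allFin a)))
    (Unique⇒length≤ (Unique.map⁺ f-injective (Unique.allFin⁺ 4)) λ fa∈ →
      let (a , _ , v≡fa) = ∈-map⁻ f fa∈ in subst (_∈ nonDominating G) (sym v≡fa) (image-nonDominating no-isolated a))

InFamily⇒nonDominating≡4 : (G : Graph n) → InFamily G → length (nonDominating G) ≡ 4
InFamily⇒nonDominating≡4 G family =
  let (s , km) = shapeOf {G = G} family in KnMinus.length-nonDominating G km (shape-noIsolated s)

ImageEdge : (Fin 4 → Fin n) → (Fin 4 → Fin 4 → Bool) → Fin n → Fin n → Set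
ImageEdge f H i j = ∃ λ a → ∃ λ b → f a ≡ i × f b ≡ j × T (H a b)

complementAlong : Graph n → (Fin 4 → Fin n) → Fin 4 → Fin 4 → Bool
complementAlong G f x y = not (adj G (f x) (f y))

isKnMinus-complementAlong : (G : Graph n) (f : Fin 4 → Fin n) → (∀ {x y} → f x ≡ f y → x ≡ y) →
  (∀ {u v} → u ≢ v → adj G u v ≡ false → ∃ λ x → f x ≡ u) → IsKnMinus G (complementAlong G f)
isKnMinus-complementAlong G f f-injective covers = f , f-injective , λ i j i≢j → forward , backward i≢j
  where
  forward : ∀ {i j} → Adjacent G i j → ¬ (ImageEdge f (complementAlong G f) i j)
  forward i~j (_ , _ , refl , refl , fx≁fy) = subst T (cong not (Equivalence.to Bool.T-≡ i~j)) fx≁fy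

  non-edge : ∀ {i j} → i ≢ j → adj G i j ≡ false → ImageEdge f (complementAlong G f) i j
  non-edge {i} {j} i≢j i≁j with covers i≢j i≁j | covers (i≢j ∘ sym) (trans (Graph.sym G j i) i≁j)
  ... | x , refl | y , refl = x , y , refl , refl , subst (T ∘ not) (sym i≁j) _

  backward : ∀ {i j} → i ≢ j → ¬ (ImageEdge f (complementAlong G f) i j) → Adjacent G i j
  backward i≢j unrelated = Equivalence.from Bool.T-≡ (Bool.¬-not (unrelated ∘ non-edge i≢j))

isKnMinus-relabel : (G : Graph n) {H H′ : Fin 4 → Fin 4 → Bool} → IsKnMinus G H′ → (g : Fin 4 → Fin 4) →
  (∀ a b → a ≢ b → H a b ≡ H′ (g a) (g b)) → (∀ {a b} → g a ≡ g b → a ≡ b) → (∀ c → ∃ λ a → g a ≡ c) →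
  IsKnMinus G H
isKnMinus-relabel G {H} {H′} (f , f-injective , correct) g H≡H′ g-injective g-onto =
  f ∘ g , g-injective ∘ f-injective , λ i j i≢j → forward i≢j , backward i≢j
  where
  forward : ∀ {i j} → i ≢ j → Adjacent G i j → ¬ (ImageEdge (f ∘ g) H i j)
  forward {i} {j} i≢j i~j (a , b , fga≡i , fgb≡j , Hab) =
    proj₁ (correct i j i≢j) i~j (g a , g b , fga≡i , fgb≡j , subst T (H≡H′ a b a≢b) Hab)
    where
    a≢b : a ≢ b
    a≢b refl = i≢j (trans (sym fga≡i) fgb≡j)

  pull : ∀ {i j} → i ≢ j → ImageEdge f H′ i j → ImageEdge (f ∘ g) H i j
  pull i≢j (x , y , refl , refl , H′xy) with g-onto x | g-onto y
  ... | a , refl | b , refl = a , b , refl , refl , subst T (sym (H≡H′ a b λ a≡b → i≢j (cong (f ∘ g) a≡b))) H′xy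

  backward : ∀ {i j} → i ≢ j → ¬ (ImageEdge (f ∘ g) H i j) → Adjacent G i j
  backward {i} {j} i≢j unrelated = proj₂ (correct i j i≢j) (unrelated ∘ pull i≢j)

-- The non-edges of G among its four non-dominating vertices form a graph without isolated vertices,
-- which classification₄ identifies with one of the seven shapes.
induced-shape : (G : Graph n) (U₄ : List (Fin n)) → nonDominating G ≡ U₄ → length U₄ ≡ 4 → InFamily G
induced-shape G U₄@(_ ∷ _ ∷ _ ∷ _ ∷ []) U≡U₄ refl =
  inFamily {G = G} s (isKnMinus-relabel G complement g H≡H′ (g-injective _ _) (proj₂ (proj₂ iso)))
  where
  f : Fin 4 → Fin _
  f = lookup U₄

  ∈-image : {u : Fin _} → u ∈ nonDominating G → ∃ λ x → f x ≡ u
  ∈-image u∈ = let p = subst (_ ∈_) U≡U₄ u∈ in index p , sym (lookup-index p)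

  complement : IsKnMinus G (complementAlong G f)
  complement = isKnMinus-complementAlong G f
    (lookup-injective (subst Unique U≡U₄ (nonDominating-unique G)) _ _)
    (λ u≢v u≁v → ∈-image (nonAdjacent⇒nonDominating G u≢v u≁v))

  complementAlong-sym : ∀ x y → complementAlong G f x y ≡ complementAlong G f y x
  complementAlong-sym x y = cong not (Graph.sym G (f x) (f y))

  no-isolated : NoIsolated (graph₄ (edges₄ (complementAlong G f)))
  no-isolated x with nonDominating⇒nonNeighbour G (subst (f x ∈_) (sym U≡U₄) (∈-lookup x))
  ... | v , fx≢v , fx≁v with ∈-image (nonAdjacent⇒nonDominating G (fx≢v ∘ sym) (trans (Graph.sym G v (f x)) fx≁v))
  ...   | y , refl = y , x≢y ,
    subst T (sym (trans (graph₄-edges₄ (complementAlong G f) complementAlong-sym x y x≢y) (cong not fx≁v))) _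
    where
    x≢y : x ≢ y
    x≢y refl = fx≢v refl

  classified = classification₄ (edges₄ (complementAlong G f)) no-isolated
  s = proj₁ classified
  g = proj₁ (proj₂ classified)
  iso = proj₂ (proj₂ classified)

  g-injective : ∀ a b → g a ≡ g b → a ≡ b
  g-injective = proj₁ (proj₂ iso)

  H≡H′ : ∀ a b → a ≢ b → graphOf s a b ≡ complementAlong G f (g a) (g b)
  H≡H′ a b a≢b = trans (proj₁ iso a b)
    (graph₄-edges₄ (complementAlong G f) complementAlong-sym (g a) (g b) (a≢b ∘ g-injective a b))

nonDominating≡4⇒InFamily : (G : Graph n) → length (nonDominating G) ≡ 4 → InFamily G
nonDominating≡4⇒InFamily G four = induced-shape G (nonDominating G) refl four

-- Connected graphs without a dominating vertex

first-neighbour : (G : Graph n) {u v : Fin n} {mid : List (Fin n)} → IsPath G u mid v → ∃ (Adjacent G u)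
first-neighbour G {mid = []} (_ , u~v ∷ _) = _ , u~v
first-neighbour G {mid = x ∷ _} (_ , u~x ∷ _) = x , u~x

distinct⇒4≤n : {a b c d : Fin n} → Unique (a ∷ b ∷ c ∷ d ∷ []) → 4 ≤ n
distinct⇒4≤n {n} abcd! = subst (4 ≤_) (length-tabulate (λ i → i)) (Unique⇒length≤ abcd! λ {x} _ → ∈-allFin x)

module _ (G : Graph n) where

  -- Take u with a non-neighbour v, the first vertex x after u on a u–v path, the first vertex y after v
  -- on a v–u path, and a non-neighbour z of x: either y ≠ x, or y = x is adjacent to u and v, so z ∉ {u, v, x}.
  noDominating⇒4≤n : Connected G → (∀ v → v ∈ nonDominating G) → Fin n → 4 ≤ n
  noDominating⇒4≤n conn all-nonDominating u
    with nonDominating⇒nonNeighbour G (all-nonDominating u)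
  ... | v , u≢v , u≁v
    with first-neighbour G (proj₂ (conn u v u≢v)) | first-neighbour G (proj₂ (conn v u (u≢v ∘ sym)))
  ...   | x , u~x | y , v~y
    with nonDominating⇒nonNeighbour G (all-nonDominating x) | y ≟ x
  ...     | _ | no y≢x = distinct⇒4≤n
    ( (u≢v ∷ adjacent⇒≢ G u~x ∷ adjacent-nonAdjacent⇒≢ G v~y v≁u ∘ sym ∷ [])
    ∷ (adjacent-nonAdjacent⇒≢ G u~x u≁v ∘ sym ∷ adjacent⇒≢ G v~y ∷ [])
    ∷ (y≢x ∘ sym ∷ []) ∷ [] ∷ [])
    where v≁u = trans (Graph.sym G v u) u≁v
  ...     | z , x≢z , x≁z | yes refl = distinct⇒4≤n
    ( (u≢v ∷ adjacent⇒≢ G u~x ∷ adjacent-nonAdjacent⇒≢ G (adjacent-sym G u~x) x≁z ∷ [])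
    ∷ (adjacent⇒≢ G v~y ∷ adjacent-nonAdjacent⇒≢ G (adjacent-sym G v~y) x≁z ∷ [])
    ∷ (x≢z ∷ []) ∷ [] ∷ [])

Linked⇒All : {P : A → Set} {R : A → A → Set} → (∀ {x y} → P x → R x y → P y) →
  ∀ {x xs} → P x → Linked R (x ∷ xs) → All P xs
Linked⇒All step px [-] = []
Linked⇒All step px (r ∷ rs) = step px r ∷ Linked⇒All step (step px r) rs

-- Here and in Route, H x y ≡ false says that x y is an edge of the complement of H.
Separates : (Fin 4 → Fin 4 → Bool) → (Fin 4 → Bool) → Fin 4 → Fin 4 → Set
Separates H C a b = T (C a) × ¬ T (C b) × (∀ x y → T (C x) → x ≢ y → H x y ≡ false → T (C y))

separates? : ∀ H C a b → Dec (Separates H C a b)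
separates? H C a b = T? (C a) ×-dec ¬? (T? (C b))
  ×-dec (all? λ x → all? λ y → T? (C x) →-dec ¬? (x ≟ y) →-dec H x y Bool.≟ false →-dec T? (C y))

Route : (Fin 4 → Fin 4 → Bool) → List (Element 4) → Fin 4 → List (Fin 4) → Fin 4 → Set
Route H S p r q =
  Unique (seqOf p r q)
  × Linked (λ x y → x ≢ y × H x y ≡ false × edgeBetween x y ∈ S) (seqOf p r q)
  × All (λ x → vertex x ∈ S) r

route? : ∀ H S p r q → Dec (Route H S p r q)
route? H S p r q = UniqueFin.unique? (seqOf p r q)
  ×-dec Linked.linked? (λ x y → ¬? (x ≟ y) ×-dec H x y Bool.≟ false ×-dec edgeBetween x y ∈ᴱ? S) (seqOf p r q)
  ×-dec All.all? (λ x → vertex x ∈ᴱ? S) r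

record Routing (H : Fin 4 → Fin 4 → Bool) : Set where
  field
    class : List (Element 4)
    hub   : Fin 4
    hub∈  : vertex hub ∈ class
    route : Fin 4 → Fin 4 → List (Fin 4)
    valid : ∀ p q → T (H p q) → Route H class p (route p q) q

pathClass : List (Fin n) → List (Element n)
pathClass (x ∷ y ∷ z ∷ xs) = edgeBetween x y ∷ vertex y ∷ pathClass (y ∷ z ∷ xs)
pathClass (x ∷ y ∷ []) = edgeBetween x y ∷ []
pathClass _ = []

module ComplementOf (G : Graph n) {H : Fin 4 → Fin 4 → Bool} (km : IsKnMinus G H)
  (onto : ∀ v → ∃ λ a → KnMinus.f G km a ≡ v) where
  open KnMinus G km

  H-nonAdjacent : {p q : Fin 4} → p ≢ q → adj G (f p) (f q) ≡ false → T (H p q)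
  H-nonAdjacent {p} {q} p≢q fp≁fq with H p q in Hpq
  ... | true = _
  ... | false = contradiction (adjacent-image p≢q Hpq) (subst (¬_ ∘ T) (sym fp≁fq) λ ())

  separated⇒disconnected : {C : Fin 4 → Bool} {a b : Fin 4} → Separates H C a b → ¬ Connected G
  separated⇒disconnected {C} {a} {b} (Ca , ¬Cb , closed) conn with conn (f a) (f b) (f-≢ a≢b)
    where a≢b : a ≢ b
          a≢b refl = ¬Cb Ca
  ... | mid , _ , links with Allₚ.++⁻ʳ mid (Linked⇒All step (a , refl , Ca) links)
    where
    step : ∀ {x y} → (∃ λ p → f p ≡ x × T (C p)) → Adjacent G x y → ∃ λ q → f q ≡ y × T (C q)
    step {y = y} (p , refl , Cp) fp~y with onto y
    ... | q , refl = q , refl , closed p q Cp p≢q Hpq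
      where
      p≢q : p ≢ q
      p≢q refl = adjacent⇒≢ G fp~y refl
      Hpq : H p q ≡ false
      Hpq with H p q in Hpq
      ... | true = contradiction (subst T (nonAdjacent-image p≢q (subst T (sym Hpq) _)) fp~y) λ ()
      ... | false = refl
  ...   | (b′ , fb′≡fb , Cb′) ∷ [] = ¬Cb (subst (T ∘ C) (f-injective fb′≡fb) Cb′)

  lift : Element 4 → Element n
  lift (vertex p) = vertex (f p)
  lift (edge (p , q)) = edgeBetween (f p) (f q)

  lift-edgeBetween : {x y : Fin 4} → x ≢ y → lift (edgeBetween x y) ≡ edgeBetween (f x) (f y)
  lift-edgeBetween {x} {y} x≢y with edgeBetween-cases x y
  ... | inj₁ eq rewrite eq = refl
  ... | inj₂ eq rewrite eq = edgeBetween-comm (f-≢ (x≢y ∘ sym))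

  lift-route : ∀ {S p r q} → Route H S p r q → PathIn G (map lift S) (f p) (map f r) (f q)
  lift-route {S} {p} {r} {q} (r! , links , inner) =
    subst Unique seq≡ (Unique.map⁺ f-injective r!) ,
    subst (Linked _) seq≡ (Linkedₚ.map⁺ (Linked.map
      (λ (x≢y , Hxy , e∈) → adjacent-image x≢y Hxy , subst (_∈ map lift S) (lift-edgeBetween x≢y) (∈-map⁺ lift e∈))
      links)) ,
    Allₚ.map⁺ (All.map (∈-map⁺ lift) inner)
    where
    seq≡ : map f (seqOf p r q) ≡ seqOf (f p) (map f r) (f q)
    seq≡ = cong (f p ∷_) (map-++ f r (q ∷ []))

  routed-colouring : (R : Routing H) → ∃ λ K → HasTMC G K × suc (n + edgeCount G) ≤ K + length (Routing.class R)
  routed-colouring R with class-colouring G (map lift class) (∈-map⁺ lift hub∈) joined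
    where
    open Routing R
    joined : ∀ u v → u ≢ v → adj G u v ≡ false → ∃ λ mid → PathIn G (map lift class) u mid v
    joined u v u≢v u≁v with onto u | onto v
    ... | p , refl | q , refl = map f (route p q) , lift-route (valid p q (H-nonAdjacent (u≢v ∘ cong f) u≁v))
  ... | K , h , bound = K , h , subst (λ l → suc (n + edgeCount G) ≤ K + l) (length-map lift (Routing.class R)) bound

private
  route-P4 : Fin 4 → Fin 4 → List (Fin 4)
  route-P4 0F 1F = 3F ∷ []
  route-P4 1F 0F = 3F ∷ []
  route-P4 1F 2F = 3F ∷ 0F ∷ []
  route-P4 2F 1F = 0F ∷ 3F ∷ []
  route-P4 2F 3F = 0F ∷ []
  route-P4 3F 2F = 0F ∷ []
  route-P4 _ _ = []

  route-2K2 : Fin 4 → Fin 4 → List (Fin 4)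
  route-2K2 0F 1F = 2F ∷ []
  route-2K2 1F 0F = 2F ∷ []
  route-2K2 2F 3F = 0F ∷ []
  route-2K2 3F 2F = 0F ∷ []
  route-2K2 _ _ = []

-- The complement of P4 is the path 2 0 3 1.
routing-P4 : Routing P4
routing-P4 = record
  { class = pathClass (2F ∷ 0F ∷ 3F ∷ 1F ∷ [])
  ; hub = 0F
  ; hub∈ = there (here refl)
  ; route = route-P4
  ; valid = toWitness {a? = all? λ p → all? λ q → T? (P4 p q) →-dec route? P4 _ p (route-P4 p q) q} _
  }

-- The complement of 2K2 is the cycle 0 2 1 3, which contains the path 1 2 0 3.
routing-2K2 : Routing 2K2
routing-2K2 = record
  { class = pathClass (1F ∷ 2F ∷ 0F ∷ 3F ∷ [])
  ; hub = 2F
  ; hub∈ = there (here refl)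
  ; route = route-2K2
  ; valid = toWitness {a? = all? λ p → all? λ q → T? (2K2 p q) →-dec route? 2K2 _ p (route-2K2 p q) q} _
  }

module _ (G : Graph n) (conn : Connected G) (all-nonDominating : ∀ v → v ∈ nonDominating G) where

  private
    onto : ∀ {H} (km : IsKnMinus G H) v → ∃ λ a → KnMinus.f G km a ≡ v
    onto km v = KnMinus.nonDominating⇒image G km (all-nonDominating v)

    routed : ∀ {H} (km : IsKnMinus G H) (R : Routing H) → length (Routing.class R) ≡ 5 →
      ∃ λ K → HasTMC G K × n + edgeCount G ≤ K + 4
    routed km R size =
      let (K , h , bound) = ComplementOf.routed-colouring G km (onto km) R
      in K , h , ≤-+suc⁻¹ K (subst (λ l → suc (n + edgeCount G) ≤ K + l) size bound)

    disconnected : ∀ {H} (km : IsKnMinus G H) C a b → {True (separates? H C a b)} →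
      ∃ λ K → HasTMC G K × n + edgeCount G ≤ K + 4
    disconnected km C a b {separated} =
      contradiction conn (ComplementOf.separated⇒disconnected G km (onto km) (toWitness separated))

  complement-colouring : ∀ s → IsKnMinus G (graphOf s) → ∃ λ K → HasTMC G K × n + edgeCount G ≤ K + 4
  complement-colouring P4ˢ    km = routed km routing-P4 refl
  complement-colouring 2K2ˢ   km = routed km routing-2K2 refl
  -- The other five complements are disconnected, and C is a union of their components.
  complement-colouring K4ˢ    km = disconnected km (λ x → ⌊ x ≟ 0F ⌋) 0F 1F
  complement-colouring K4-K2ˢ km = disconnected km (λ x → ⌊ x ≟ 2F ⌋) 2F 0F
  complement-colouring K4-P3ˢ km = disconnected km (λ x → ⌊ x ≟ 3F ⌋) 3F 0F
  complement-colouring C4ˢ    km = disconnected km (λ x → ⌊ x ≟ 0F ⌋ ∨ ⌊ x ≟ 2F ⌋) 0F 1F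
  complement-colouring K13ˢ   km = disconnected km (λ x → ⌊ x ≟ 0F ⌋) 0F 1F

module _ (G : Graph n) (conn : Connected G) where

  private
    some-vertex : ∀ {m} (H : Graph m) → k + 4 ≡ edgeCount H + m → Fin m
    some-vertex {m = zero} H k+4≡0 = contradiction (trans k+4≡0 (ℕ.+-identityʳ _)) (ℕ.m+1+n≢0 _)
    some-vertex {m = suc _} H _ = zero

    tmc-of-colouring : length (nonDominating G) ≡ 4 →
      (∃ λ K → HasTMC G K × n + edgeCount G ≤ K + length (nonDominating G)) →
      ∃ λ k → TmcIs G k × k + 4 ≡ edgeCount G + n
    tmc-of-colouring four (K , h , lower) =
      let (tmc , K+U≡) = tmc-from-colouring G h lower
      in K , tmc , trans (cong (K +_) (sym four)) (trans K+U≡ (ℕ.+-comm n _))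

  tmc⇒nonDominating≡4 : TmcIs G k → k + 4 ≡ edgeCount G + n → length (nonDominating G) ≡ 4
  tmc⇒nonDominating≡4 {k} tmc k+4≡ with any? (dominating? G)
  ... | yes (w , w-dom) = ℕ.+-cancelˡ-≡ k _ _ (trans (tmc-dominating G w-dom tmc) (trans (ℕ.+-comm n _) (sym k+4≡)))
  ... | no none = trans (noDominating⇒length G none)
    (ℕ.≤-antisym n≤4 (noDominating⇒4≤n G conn (noDominating⇒all G none) (some-vertex G k+4≡)))
    where
    n≤4 : n ≤ 4
    n≤4 = ℕ.+-cancelˡ-≤ k n 4 (subst (k + n ≤_) (trans (ℕ.+-comm n _) (sym k+4≡))
            (subst (λ l → k + l ≤ n + edgeCount G) (noDominating⇒length G none) (tmc+nonDominating≤ G (proj₁ tmc))))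

  InFamily⇒tmc : InFamily G → ∃ λ k → TmcIs G k × k + 4 ≡ edgeCount G + n
  InFamily⇒tmc family with InFamily⇒nonDominating≡4 G family | any? (dominating? G)
  ... | four | yes (w , w-dom) = tmc-of-colouring four (dominating-colouring G w-dom)
  ... | four | no none =
    let (s , km) = shapeOf {G = G} family ; (K , h , bound) = complement-colouring G conn (noDominating⇒all G none) s km
    in tmc-of-colouring four (K , h , subst (λ l → n + edgeCount G ≤ K + l) (sym four) bound)

theorem9 : ∀ (n : ℕ) (G : Graph n) → Connected G →
    (∃ λ k → TmcIs G k × k + 4 ≡ edgeCount G + n) ⇔ InFamily G
theorem9 n G conn = mk⇔
  (λ (k , tmc , k+4≡) → nonDominating≡4⇒InFamily G (tmc⇒nonDominating≡4 G conn tmc k+4≡))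
  (InFamily⇒tmc G conn)
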